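{- Let $P$ and $Q$ be $s\times t$ $(0,1)$-matrices with $P\le Q$ entrywise, and let $m\ge s$, $n\ge t$. Let $A_P$ (resp. $A_Q$) be the unique $m\times n$ $P$-forcing (resp. $Q$-forcing) matrix with the minimum number of $1$-entries. Then $A_P\le A_Q$ entrywise, and consequently $\mathrm{m}(m,n,P)\le \mathrm{m}(m,n,Q)$.
   Context: All matrices are $(0,1)$-matrices. An $s\times t$ submatrix of an $m\times n$ matrix is obtained by choosing any $s$ rows and any $t$ columns (not necessarily consecutive), keeping their order. For $m\ge s$, $n\ge t$, an $m\times n$ matrix $A$ is $Q$-forcing (for an $s\times t$ matrix $Q$) if every $s\times t$ submatrix of $A$ is entrywise $\ge Q$ (i.e. can be turned into $Q$ by changing some $1$-entries to $0$). For each such $Q$, $m$, $n$ there is a unique $m\times n$ $Q$-forcing matrix with the minimum number of $1$-entries. $\mathrm{m}(m,n,Q)$ denotes the minimum number of $1$-entries of an $m\times n$ $Q$-forcing matrix. -}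

module Defs where

open import Data.Bool using (Bool; true; false; _≤_)
open import Data.Nat as ℕ using (ℕ)
open import Data.Fin using (Fin; _<_)
open import Data.List using (map; allFin)
open import Data.Nat.ListAction using (sum)
open import Data.Product using (Σ; _×_)
open import Relation.Binary.PropositionalEquality using (_≡_)

-- An m × n (0,1)-matrix: entries true = 1, false = 0.
Matrix : ℕ → ℕ → Set
Matrix m n = Fin m → Fin n → Bool

_≤ᴹ_ : ∀ {m n} → Matrix m n → Matrix m n → Set
A ≤ᴹ B = ∀ i j → A i j ≤ B i j

StrictlyIncreasing : ∀ {k m} → (Fin k → Fin m) → Set
StrictlyIncreasing {k} f = ∀ (i j : Fin k) → i < j → f i < f j

submatrix : ∀ {s t m n} → Matrix m n → (Fin s → Fin m) → (Fin t → Fin n) → Matrix s t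
submatrix A r c i j = A (r i) (c j)

Forcing : ∀ {s t m n} → Matrix s t → Matrix m n → Set
Forcing {s} {t} {m} {n} Q A =
  ∀ (r : Fin s → Fin m) (c : Fin t → Fin n) →
  StrictlyIncreasing r → StrictlyIncreasing c → Q ≤ᴹ submatrix A r c

bit : Bool → ℕ
bit true = 1
bit false = 0

ones : ∀ {m n} → Matrix m n → ℕ
ones {m} {n} A = sum (map (λ i → sum (map (λ j → bit (A i j)) (allFin n))) (allFin m))

MinForcing : ∀ {s t m n} → Matrix s t → Matrix m n → Set
MinForcing {m = m} {n = n} Q A =
  Forcing Q A × (∀ (B : Matrix m n) → Forcing Q B → ones A ℕ.≤ ones B)

IsMinCount : ∀ {s t} → ℕ → ℕ → Matrix s t → ℕ → Set
IsMinCount m n Q k =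
  Σ (Matrix m n) (λ A → Forcing Q A × ones A ≡ k)
  × (∀ (B : Matrix m n) → Forcing Q B → k ℕ.≤ ones B)

module Submission where

open import Defs
open import Data.Bool using (true; false; _∧_; _<_; b≤b; f≤t; f<t)
  renaming (_≤_ to _≤ᵇ_)
open import Data.Bool.Properties using (≤-minimum; ≤-trans; _≤?_)
open import Data.Empty using (⊥-elim)
open import Data.List using (List; []; _∷_; map; allFin)
open import Data.List.Membership.Propositional using (_∈_)
open import Data.List.Membership.Propositional.Properties using (∈-allFin)
open import Data.List.Relation.Unary.Any using (here; there)
open import Data.Nat using (ℕ; _≤_; z≤n; s≤s) renaming (_<_ to _<ℕ_)
open import Data.Nat.ListAction using (sum)
open import Data.Nat.Properties using (≤-refl; +-mono-≤; +-mono-<-≤; +-mono-≤-<; <⇒≱)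
open import Data.Product using (_×_; _,_)
open import Relation.Binary.PropositionalEquality using (refl; subst)
open import Relation.Nullary using (¬_; yes; no)

-- The minimum P-forcing matrix is in fact the least one: meeting it with any
-- other P-forcing matrix stays P-forcing, and cannot lose a 1-entry without
-- contradicting minimality. A Q-forcing matrix is P-forcing when P ≤ Q.

private
  variable
    s t m n : ℕ

sum-map-mono-≤ : ∀ {A : Set} {f g : A → ℕ} (xs : List A) → (∀ x → f x ≤ g x) →
  sum (map f xs) ≤ sum (map g xs)
sum-map-mono-≤ []       f≤g = z≤n
sum-map-mono-≤ (x ∷ xs) f≤g = +-mono-≤ (f≤g x) (sum-map-mono-≤ xs f≤g)

sum-map-mono-< : ∀ {A : Set} {f g : A → ℕ} {xs : List A} → (∀ x → f x ≤ g x) →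
  ∀ {x} → x ∈ xs → f x <ℕ g x → sum (map f xs) <ℕ sum (map g xs)
sum-map-mono-< {xs = _ ∷ xs} f≤g (here refl) fx<gx = +-mono-<-≤ fx<gx (sum-map-mono-≤ xs f≤g)
sum-map-mono-< {xs = y ∷ _}  f≤g (there x∈xs) fx<gx = +-mono-≤-< (f≤g y) (sum-map-mono-< f≤g x∈xs fx<gx)

bit-mono-≤ : ∀ {a b} → a ≤ᵇ b → bit a ≤ bit b
bit-mono-≤ b≤b = ≤-refl
bit-mono-≤ f≤t = z≤n

bit-mono-< : ∀ {a b} → a < b → bit a <ℕ bit b
bit-mono-< f<t = s≤s z≤n

∧-greatest : ∀ {a x y} → a ≤ᵇ x → a ≤ᵇ y → a ≤ᵇ x ∧ y
∧-greatest {x = false} a≤x _   = a≤x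
∧-greatest {x = true}  _   a≤y = a≤y

∧-lowerˡ : ∀ x y → x ∧ y ≤ᵇ x
∧-lowerˡ false _     = b≤b
∧-lowerˡ true  false = f≤t
∧-lowerˡ true  true  = b≤b

∧-<ˡ : ∀ {x y} → ¬ x ≤ᵇ y → x ∧ y < x
∧-<ˡ {false} {y}     x≰y = ⊥-elim (x≰y (≤-minimum y))
∧-<ˡ {true}  {false} _   = f<t
∧-<ˡ {true}  {true}  x≰y = ⊥-elim (x≰y b≤b)

_∧ᴹ_ : Matrix m n → Matrix m n → Matrix m n
(A ∧ᴹ B) i j = A i j ∧ B i j

ones-mono-< : {A B : Matrix m n} → A ≤ᴹ B → ∀ i j → A i j < B i j → ones A <ℕ ones B
ones-mono-< {n = n} A≤B i j Aij<Bij =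
  sum-map-mono-< (λ i′ → sum-map-mono-≤ (allFin n) (λ j′ → bit-mono-≤ (A≤B i′ j′))) (∈-allFin i)
    (sum-map-mono-< (λ j′ → bit-mono-≤ (A≤B i j′)) (∈-allFin j) (bit-mono-< Aij<Bij))

Forcing-antitone : {P Q : Matrix s t} (A : Matrix m n) → P ≤ᴹ Q → Forcing Q A → Forcing P A
Forcing-antitone _ P≤Q forcing r c r↑ c↑ i j = ≤-trans (P≤Q i j) (forcing r c r↑ c↑ i j)

Forcing-∧ : {P : Matrix s t} (A B : Matrix m n) → Forcing P A → Forcing P B → Forcing P (A ∧ᴹ B)
Forcing-∧ _ _ forcingA forcingB r c r↑ c↑ i j =
  ∧-greatest (forcingA r c r↑ c↑ i j) (forcingB r c r↑ c↑ i j)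

MinForcing-least : {P : Matrix s t} (A B : Matrix m n) → MinForcing P A → Forcing P B → A ≤ᴹ B
MinForcing-least A B (forcingA , minimal) forcingB i j with A i j ≤? B i j
... | yes Aij≤Bij = Aij≤Bij
... | no  Aij≰Bij = ⊥-elim (<⇒≱ fewer (minimal (A ∧ᴹ B) (Forcing-∧ A B forcingA forcingB)))
  where
  fewer : ones (A ∧ᴹ B) <ℕ ones A
  fewer = ones-mono-< (λ i′ j′ → ∧-lowerˡ (A i′ j′) (B i′ j′)) i j (∧-<ˡ Aij≰Bij)

corollary1 : ∀ {s t : ℕ} (P Q : Matrix s t) (m n : ℕ) →
    P ≤ᴹ Q → s ≤ m → t ≤ n →
    (∀ (AP AQ : Matrix m n) → MinForcing P AP → MinForcing Q AQ → AP ≤ᴹ AQ)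
    × (∀ (k l : ℕ) → IsMinCount m n P k → IsMinCount m n Q l → k ≤ l)
corollary1 P Q m n P≤Q _ _ = least , count
  where
  least : ∀ (AP AQ : Matrix m n) → MinForcing P AP → MinForcing Q AQ → AP ≤ᴹ AQ
  least _ AQ minP (forcingQ , _) = MinForcing-least _ AQ minP (Forcing-antitone AQ P≤Q forcingQ)

  count : ∀ (k l : ℕ) → IsMinCount m n P k → IsMinCount m n Q l → k ≤ l
  count k l (_ , minimalP) ((AQ , forcingQ , ones≡l) , _) =
    subst (k ≤_) ones≡l (minimalP AQ (Forcing-antitone AQ P≤Q forcingQ))
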